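{- For every type expression $M$, the set $[\![M]\!]$ is a regular term language over $\Sigma$, i.e. it is the set of ground terms recognized by some finite tree automaton over $\Sigma$.
   Context: Let $\Sigma$ be a finite ranked alphabet of function symbols containing at least one constant, and $T(\Sigma)$ the set of ground terms over $\Sigma$. Let $\Pi$ be a finite ranked alphabet of type constructors, disjoint from $\Sigma$ and from $\{\sqcap,\sqcup,\neg,\top,\bot\}$. A type expression is a ground term over $\Pi\cup\{\sqcap,\sqcup,\neg,\top,\bot\}$ ($\sqcap,\sqcup$ binary, $\neg$ unary, $\top,\bot$ constants). A type rule has the form $c(\zeta_1,\dots,\zeta_m)\to\tau$ with $c\in\Pi$ of arity $m$, $\zeta_1,\dots,\zeta_m$ distinct type parameters. $\Delta$ is a fixed finite set of type rules which is simplified: every right-hand side is $f(\tau_1,\dots,\tau_n)$ with $f\in\Sigma$ of arity $n$ and each $\tau_j$ either some $\zeta_i$ or $d(\zeta'_1,\dots,\zeta'_k)$ with $d\in\Pi$, $\zeta'_l\in\{\zeta_1,\dots,\zeta_m\}$. $ground(\Delta)$ is the set of all rules obtained from rules of $\Delta$ by replacing the parameters by type expressions (consistently), together with $\top\to f(\top,\dots,\top)$ for all $f\in\Sigma$. Semantics: $[\![\top]\!]=T(\Sigma)$, $[\![\bot]\!]=\emptyset$, $[\![E_1\sqcap E_2]\!]=[\![E_1]\!]\cap[\![E_2]\!]$, $[\![E_1\sqcup E_2]\!]=[\![E_1]\!]\cup[\![E_2]\!]$, $[\![\neg E]\!]=T(\Sigma)\setminus[\![E]\!]$, and for $\omega$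 with principal symbol in $\Pi$, $[\![\omega]\!]=\bigcup_{(\omega\to f(E_1,\dots,E_n))\in ground(\Delta)}\{f(t_1,\dots,t_n): t_i\in[\![E_i]\!]\text{ for all }i\}$ (membership defined by recursion on term size). -}

module Defs where

open import Data.Nat using (ℕ)
open import Data.Fin using (Fin)
open import Data.Bool using (Bool; T)
open import Data.List using (List)
open import Data.List.Relation.Unary.Any using (Any)
open import Data.Product using (Σ; _×_)
open import Data.Sum using (_⊎_)
open import Data.Unit using (⊤)
open import Data.Empty using (⊥)
open import Relation.Nullary using (¬_)
open import Relation.Binary.PropositionalEquality using (_≡_; subst; sym)

record Ranked : Set where
  field
    size  : ℕ
    arity : Fin size → ℕ
open Ranked public

data Term (S : Ranked) : Set where
  node : (f : Fin (size S)) → (Fin (arity S f) → Term S) → Term S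

data TExp (P : Ranked) : Set where
  top bot : TExp P
  _⊓_ _⊔_ : TExp P → TExp P → TExp P
  neg : TExp P → TExp P
  con : (c : Fin (size P)) → (Fin (arity P c) → TExp P) → TExp P

module _ (S P : Ranked) where

  -- An argument τ_j of a simplified right-hand side, for a rule whose lhs
  -- c(ζ_1,…,ζ_m) has m parameters (indexed by Fin m):
  -- either a parameter ζ_i, or d(ζ'_1,…,ζ'_k) with ζ'_l among the ζ_i.
  data RArg (m : ℕ) : Set where
    par : Fin m → RArg m
    app : (d : Fin (size P)) → (Fin (arity P d) → Fin m) → RArg m

  -- A simplified type rule  c(ζ_1,…,ζ_m) → f(τ_1,…,τ_n).
  record Rule : Set where
    constructor rule
    field
      lhs  : Fin (size P)
      fun  : Fin (size S)
      args : Fin (arity S fun) → RArg (arity P lhs)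

  inst : {m : ℕ} → (Fin m → TExp P) → RArg m → TExp P
  inst σ (par i)   = σ i
  inst σ (app d g) = con d (λ l → σ (g l))

  -- For ω = c(E_1..E_m): t ∈ [[ω]] iff some rule of Δ with lhs c and
  -- rhs f(τ_1..τ_n) has t = f(t_1..t_n) with t_j ∈ [[τ_j[ζ_i := E_i]]].
  Mem : List Rule → Term S → TExp P → Set
  Mem Δ t top = ⊤
  Mem Δ t bot = ⊥
  Mem Δ t (E₁ ⊓ E₂) = Mem Δ t E₁ × Mem Δ t E₂
  Mem Δ t (E₁ ⊔ E₂) = Mem Δ t E₁ ⊎ Mem Δ t E₂
  Mem Δ t (neg E) = ¬ Mem Δ t E
  Mem Δ (node f ts) (con c σ) =
    Any (λ r → Σ (Rule.lhs r ≡ c) λ e₁ → Σ (Rule.fun r ≡ f) λ e₂ →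
           (j : Fin (arity S (Rule.fun r))) →
             Mem Δ (ts (subst (λ g → Fin (arity S g)) e₂ j))
                   (inst (λ i → σ (subst (λ d → Fin (arity P d)) e₁ i)) (Rule.args r j)))
        Δ

record TA (S : Ranked) : Set where
  field
    states : ℕ
    δ      : (f : Fin (size S)) → (Fin (arity S f) → Fin states) → Fin states → Bool
    final  : Fin states → Bool

module _ {S : Ranked} (A : TA S) where
  open TA A

  Reaches : Term S → Fin states → Set
  Reaches (node f ts) q =
    Σ (Fin (arity S f) → Fin states) λ qs →
      ((j : Fin (arity S f)) → Reaches (ts j) (qs j)) × T (δ f qs q)

  Accepts : Term S → Set
  Accepts t = Σ (Fin states) λ q → Reaches t q × T (final q)

Regular : (S : Ranked) → (Term S → Set) → Set
Regular S L = Σ (TA S) λ A → (t : Term S) → (L t → Accepts A t) × (Accepts A t → L t)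

{-# OPTIONS --safe #-}
module Submission where

-- By induction on M we build a deterministic bottom-up automaton with a Boolean acceptance
-- predicate on its states.  Boolean connectives are handled by product automata.  For
-- c(σ₁,…,σₘ), a rule only ever produces arguments σᵢ or d(σ_{g 1},…,σ_{g k}) with
-- g : Fin k → Fin m, and whether f(t₁,…,tₙ) belongs to such a d(…) depends only on the
-- memberships of the tⱼ in expressions of these two kinds.  There are finitely many of them,
-- so one automaton decides all of them at once: its state is the state of the product of
-- the automata for the σᵢ together with one bit for every pair (d, g).

open import Defs
open import Data.Bool using (Bool; true; false; T; _∧_; _∨_; not)
open import Data.Bool.Properties using (T-∧; T-∨)
open import Data.Fin using (Fin; zero; suc; _≟_; combine; quotient; remainder; funToFin; finToFun)
open import Data.Fin.Properties using (remQuot-combine; finToFun-funToFin; 2↔Bool; all?)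
open import Data.List using (List)
open import Data.List.Relation.Unary.Any as Any using (Any; any?)
open import Data.Nat using (ℕ; zero; suc; _*_; _^_)
open import Data.Product using (Σ; _×_; _,_; proj₁; proj₂)
open import Data.Product.Function.NonDependent.Propositional using (_×-⇔_)
open import Data.Sum using (_⊎_)
open import Data.Sum.Function.Propositional using (_⊎-⇔_)
open import Data.Unit using (tt)
open import Data.Vec using (Vec; tabulate; lookup; map)
open import Data.Vec.Properties using (lookup∘tabulate; tabulate-cong; tabulate-∘)
open import Function using (_∘_; id; const)
open import Function.Bundles using (_⇔_; mk⇔; Equivalence; Inverse)
import Function.Properties.Equivalence as ⇔
open import Function.Related.Propositional using (module EquationalReasoning)
open import Function.Related.TypeIsomorphisms using (¬-cong-⇔)
open import Relation.Nullary using (¬_; Dec; yes; no)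
open import Relation.Nullary.Decidable using (⌊_⌋; toWitness; fromWitness; T?; map′)
open import Relation.Binary.PropositionalEquality
  using (_≡_; refl; sym; trans; cong; subst; _≗_; module ≡-Reasoning)

∏ : (n : ℕ) → (Fin n → ℕ) → ℕ
∏ zero    N = 1
∏ (suc n) N = N zero * ∏ n (N ∘ suc)

pack : ∀ {n} {N : Fin n → ℕ} → ((i : Fin n) → Fin (N i)) → Fin (∏ n N)
pack {zero}  v = zero
pack {suc n} v = combine (v zero) (pack (v ∘ suc))

unpack : ∀ {n} {N : Fin n → ℕ} → Fin (∏ n N) → (i : Fin n) → Fin (N i)
unpack {suc n} {N} x zero    = quotient (∏ n (N ∘ suc)) x
unpack {suc n} {N} x (suc i) = unpack (remainder {N zero} (∏ n (N ∘ suc)) x) i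

unpack-pack : ∀ {n} {N : Fin n → ℕ} (v : (i : Fin n) → Fin (N i)) i → unpack {N = N} (pack v) i ≡ v i
unpack-pack {suc n}     v zero    = cong proj₁ (remQuot-combine (v zero) (pack (v ∘ suc)))
unpack-pack {suc n} {N} v (suc i) = begin
  unpack (remainder {N zero} _ (combine (v zero) (pack (v ∘ suc)))) i
    ≡⟨ cong (λ x → unpack (proj₂ x) i) (remQuot-combine (v zero) (pack (v ∘ suc))) ⟩
  unpack (pack (v ∘ suc)) i
    ≡⟨ unpack-pack (v ∘ suc) i ⟩
  v (suc i)
    ∎
  where open ≡-Reasoning

BoolTable : (n : ℕ) → (Fin n → ℕ) → ℕ
BoolTable n K = ∏ n (λ d → 2 ^ K d)

module _ {n : ℕ} {K : Fin n → ℕ} where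

  toTable : ((d : Fin n) → Fin (K d) → Bool) → Fin (BoolTable n K)
  toTable b = pack (λ d → funToFin (Inverse.from 2↔Bool ∘ b d))

  entry : Fin (BoolTable n K) → (d : Fin n) → Fin (K d) → Bool
  entry x d = Inverse.to 2↔Bool ∘ finToFun (unpack x d)

  entry-toTable : ∀ b d k → entry (toTable b) d k ≡ b d k
  entry-toTable b d k = begin
    Inverse.to 2↔Bool (finToFun (unpack (toTable b) d) k)
      ≡⟨ cong (λ x → Inverse.to 2↔Bool (finToFun x k)) (unpack-pack _ d) ⟩
    Inverse.to 2↔Bool (finToFun (funToFin (Inverse.from 2↔Bool ∘ b d)) k)
      ≡⟨ cong (Inverse.to 2↔Bool) (finToFun-funToFin _ k) ⟩
    Inverse.to 2↔Bool (Inverse.from 2↔Bool (b d k))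
      ≡⟨ Inverse.strictlyInverseˡ 2↔Bool (b d k) ⟩
    b d k
      ∎
    where open ≡-Reasoning

T-not : ∀ x → T (not x) ⇔ (¬ T x)
T-not false = mk⇔ (λ _ ()) (const tt)
T-not true  = mk⇔ (λ ()) (λ ¬⊤ → ¬⊤ tt)

module _ {S : Ranked} where

  record DFTA : Set where
    field
      states : ℕ
      step   : (f : Fin (size S)) → Vec (Fin states) (arity S f) → Fin states

  open DFTA

  run : (A : DFTA) → Term S → Fin (states A)
  run A (node f ts) = step A f (tabulate (run A ∘ ts))

  Decides : (A : DFTA) → (Fin (states A) → Bool) → (Term S → Set) → Set
  Decides A accepting L = ∀ t → T (accepting (run A t)) ⇔ L t

  record Recogniser (L : Term S → Set) : Set where
    field
      automaton : DFTA
      accepting : Fin (states automaton) → Bool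
      decides   : Decides automaton accepting L

  record JointRecogniser {n} (L : Fin n → Term S → Set) : Set where
    field
      automaton : DFTA
      accepting : Fin n → Fin (states automaton) → Bool
      decides   : ∀ i → Decides automaton (accepting i) (L i)

  toTA : (A : DFTA) → (Fin (states A) → Bool) → TA S
  toTA A accepting = record
    { states = states A
    ; δ      = λ f qs q → ⌊ step A f (tabulate qs) ≟ q ⌋
    ; final  = accepting
    }

  module _ (A : DFTA) (accepting : Fin (states A) → Bool) where

    reaches-run : ∀ t → Reaches (toTA A accepting) t (run A t)
    reaches-run (node f ts) = run A ∘ ts , reaches-run ∘ ts , fromWitness refl

    reaches⇒≡run : ∀ t q → Reaches (toTA A accepting) t q → q ≡ run A t
    reaches⇒≡run (node f ts) q (qs , reaches , stepped) =
      trans (sym (toWitness stepped))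
            (cong (step A f) (tabulate-cong λ j → reaches⇒≡run (ts j) (qs j) (reaches j)))

  Recogniser⇒Regular : ∀ {L} → Recogniser L → Regular S L
  Recogniser⇒Regular record { automaton = A ; accepting = accepting ; decides = decides } =
    toTA A accepting , λ t →
      (λ t∈L → run A t , reaches-run A accepting t , Equivalence.from (decides t) t∈L) ,
      (λ { (q , reaches , final) → Equivalence.to (decides t)
             (subst (T ∘ accepting) (reaches⇒≡run A accepting t q reaches) final) })

  trivial : DFTA
  trivial = record { states = 1 ; step = λ _ _ → zero }

  ⨂ : ∀ {n} → (Fin n → DFTA) → DFTA
  ⨂ {n} A = record
    { states = ∏ n (states ∘ A)
    ; step   = λ f qs → pack λ i → step (A i) f (map (λ q → unpack q i) qs)
    }

  unpack-run-⨂ : ∀ {n} (A : Fin n → DFTA) t i → unpack (run (⨂ A) t) i ≡ run (A i) t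
  unpack-run-⨂ A (node f ts) i = begin
    unpack (run (⨂ A) (node f ts)) i
      ≡⟨ unpack-pack _ i ⟩
    step (A i) f (map (λ q → unpack q i) (tabulate (run (⨂ A) ∘ ts)))
      ≡⟨ cong (step (A i) f) (tabulate-∘ _ _) ⟨
    step (A i) f (tabulate (λ j → unpack (run (⨂ A) (ts j)) i))
      ≡⟨ cong (step (A i) f) (tabulate-cong λ j → unpack-run-⨂ A (ts j) i) ⟩
    run (A i) (node f ts)
      ∎
    where open ≡-Reasoning

  Decides-⨂ : ∀ {n} (A : Fin n → DFTA) i accepting {L} →
              Decides (A i) accepting L → Decides (⨂ A) (λ q → accepting (unpack q i)) L
  Decides-⨂ A i accepting {L} decides t =
    subst (λ q → T (accepting q) ⇔ L t) (sym (unpack-run-⨂ A t i)) (decides t)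

  ⨂-recogniser : ∀ {n} {L : Fin n → Term S → Set} → ((i : Fin n) → Recogniser (L i)) → JointRecogniser L
  ⨂-recogniser R = record
    { automaton = ⨂ (automaton ∘ R)
    ; accepting = λ i q → accepting (R i) (unpack {N = states ∘ automaton ∘ R} q i)
    ; decides   = λ i → Decides-⨂ (automaton ∘ R) i (accepting (R i)) (decides (R i))
    }
    where open Recogniser

  pair : DFTA → DFTA → Fin 2 → DFTA
  pair A B zero    = A
  pair A B (suc _) = B

  _⊗_ : DFTA → DFTA → DFTA
  A ⊗ B = ⨂ (pair A B)

  module _ {A : DFTA} (a b : Fin (states A) → Bool) {L₁ L₂ : Term S → Set} where

    Decides-∧ : Decides A a L₁ → Decides A b L₂ → Decides A (λ q → a q ∧ b q) (λ t → L₁ t × L₂ t)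
    Decides-∧ decides₁ decides₂ t = ⇔.trans T-∧ (decides₁ t ×-⇔ decides₂ t)

    Decides-∨ : Decides A a L₁ → Decides A b L₂ → Decides A (λ q → a q ∨ b q) (λ t → L₁ t ⊎ L₂ t)
    Decides-∨ decides₁ decides₂ t = ⇔.trans T-∨ (decides₁ t ⊎-⇔ decides₂ t)

  Decides-not : ∀ {A} a {L} → Decides A a L → Decides A (not ∘ a) (λ t → ¬ L t)
  Decides-not {A} a {L} decides t = ⇔.trans (T-not (a (run A t))) (¬-cong-⇔ (decides t))

  module _ {L₁ L₂ : Term S → Set} (R₁ : Recogniser L₁) (R₂ : Recogniser L₂) where
    open Recogniser R₁ renaming (automaton to A₁; accepting to a₁; decides to decides₁)
    open Recogniser R₂ renaming (automaton to A₂; accepting to a₂; decides to decides₂)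

    private
      accepting₁ accepting₂ : Fin (states (A₁ ⊗ A₂)) → Bool
      accepting₁ q = a₁ (unpack {N = states ∘ pair A₁ A₂} q zero)
      accepting₂ q = a₂ (unpack {N = states ∘ pair A₁ A₂} q (suc zero))

      decides-accepting₁ : Decides (A₁ ⊗ A₂) accepting₁ L₁
      decides-accepting₁ = Decides-⨂ (pair A₁ A₂) zero a₁ decides₁

      decides-accepting₂ : Decides (A₁ ⊗ A₂) accepting₂ L₂
      decides-accepting₂ = Decides-⨂ (pair A₁ A₂) (suc zero) a₂ decides₂

    ∩-recogniser : Recogniser (λ t → L₁ t × L₂ t)
    ∩-recogniser = record
      { automaton = A₁ ⊗ A₂
      ; accepting = λ q → accepting₁ q ∧ accepting₂ q
      ; decides   = Decides-∧ {A = A₁ ⊗ A₂} accepting₁ accepting₂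
                      decides-accepting₁ decides-accepting₂
      }

    ∪-recogniser : Recogniser (λ t → L₁ t ⊎ L₂ t)
    ∪-recogniser = record
      { automaton = A₁ ⊗ A₂
      ; accepting = λ q → accepting₁ q ∨ accepting₂ q
      ; decides   = Decides-∨ {A = A₁ ⊗ A₂} accepting₁ accepting₂
                      decides-accepting₁ decides-accepting₂
      }

  ∁-recogniser : ∀ {L} → Recogniser L → Recogniser (λ t → ¬ L t)
  ∁-recogniser R = record
    { automaton = automaton
    ; accepting = not ∘ accepting
    ; decides   = Decides-not accepting decides
    }
    where open Recogniser R

module Semantics (S P : Ranked) (Δ : List (Rule S P)) where

  open DFTA

  ⟦_⟧ : TExp P → Term S → Set
  ⟦ M ⟧ t = Mem S P Δ t M

  ChildTest : Set → ℕ → Set₁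
  ChildTest X n = Fin n → ∀ {k} → (Fin k → X) → RArg S P k → Set

  -- For every ρ, ⟦ con c (φ ∘ ρ) ⟧ (node f ts) is by definition
  -- Any (Applies f (λ j g τ → ⟦ inst S P (φ ∘ g) τ ⟧ (ts j)) c ρ) Δ.
  Applies : ∀ {X} f → ChildTest X (arity S f) → ∀ c → (Fin (arity P c) → X) → Rule S P → Set
  Applies f C c ρ r =
    Σ (Rule.lhs r ≡ c) λ e₁ → Σ (Rule.fun r ≡ f) λ e₂ → (j : Fin (arity S (Rule.fun r))) →
      C (subst (λ g → Fin (arity S g)) e₂ j)
        (λ i → ρ (subst (λ d → Fin (arity P d)) e₁ i))
        (Rule.args r j)

  module _ {X : Set} {f : Fin (size S)} {c : Fin (size P)} {ρ : Fin (arity P c) → X} where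

    Applies-map : {C₁ C₂ : ChildTest X (arity S f)} → (∀ j {k} g τ → C₁ j {k} g τ → C₂ j g τ) →
                  ∀ {r} → Applies f C₁ c ρ r → Applies f C₂ c ρ r
    Applies-map C₁⇒C₂ {r} (e₁ , e₂ , holds) = e₁ , e₂ , λ j → C₁⇒C₂ _ _ (Rule.args r j) (holds j)

    Applies-cong : {C₁ C₂ : ChildTest X (arity S f)} → (∀ j {k} g τ → C₁ j {k} g τ ⇔ C₂ j g τ) →
                   Any (Applies f C₁ c ρ) Δ ⇔ Any (Applies f C₂ c ρ) Δ
    Applies-cong C₁⇔C₂ = mk⇔
      (Any.map (Applies-map λ j g τ → Equivalence.to (C₁⇔C₂ j g τ)))
      (Any.map (Applies-map λ j g τ → Equivalence.from (C₁⇔C₂ j g τ)))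

    applies? : {C : ChildTest X (arity S f)} → (∀ j {k} g τ → Dec (C j {k} g τ)) →
               ∀ r → Dec (Applies f C c ρ r)
    applies? C? (rule c′ f′ args) with c′ ≟ c | f′ ≟ f
    ... | yes refl | yes refl = map′ (λ holds → refl , refl , holds) (λ { (refl , refl , holds) → holds })
                                     (all? λ j → C? j _ (args j))
    ... | no c′≢c  | _        = no (c′≢c ∘ proj₁)
    ... | yes _    | no f′≢f  = no (f′≢f ∘ proj₁ ∘ proj₂)

  con-cong : ∀ t d {φ ψ : Fin (arity P d) → TExp P} → φ ≗ ψ → ⟦ con d φ ⟧ t ⇔ ⟦ con d ψ ⟧ t
  inst-cong : ∀ t {k} {φ ψ : Fin k → TExp P} → φ ≗ ψ →
              ∀ τ → ⟦ inst S P φ τ ⟧ t ⇔ ⟦ inst S P ψ τ ⟧ t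

  con-cong (node f ts) d φ≗ψ = Applies-cong {ρ = id} λ j g τ → inst-cong (ts j) (φ≗ψ ∘ g) τ

  inst-cong t φ≗ψ (par i) rewrite φ≗ψ i = ⇔.refl
  inst-cong t φ≗ψ (app d h)             = con-cong t d (φ≗ψ ∘ h)

  module Closure {m} (σ : Fin m → TExp P) (J : JointRecogniser (λ i → ⟦ σ i ⟧)) where

    open JointRecogniser J renaming (automaton to A)

    Codes : Fin (size P) → ℕ
    Codes d = m ^ arity P d

    Table : ℕ
    Table = BoolTable (size P) Codes

    State : Set
    State = Fin (states A * Table)

    base : State → Fin (states A)
    base = quotient Table

    bit : State → (d : Fin (size P)) → Fin (Codes d) → Bool
    bit q = entry (remainder {states A} Table q)

    argBit : State → ∀ {k} → (Fin k → Fin m) → RArg S P k → Bool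
    argBit q g (par i)   = accepting (g i) (base q)
    argBit q g (app d h) = bit q d (funToFin (g ∘ h))

    anyApplies : ∀ f → Vec State (arity S f) → (d : Fin (size P)) → Fin (Codes d) → Bool
    anyApplies f qs d code =
      ⌊ any? (applies? {ρ = finToFun code} λ j g τ → T? (argBit (lookup qs j) g τ)) Δ ⌋

    closure : DFTA
    closure = record
      { states = states A * Table
      ; step   = λ f qs → combine (step A f (map base qs)) (toTable (anyApplies f qs))
      }

    base-step : ∀ f qs → base (step closure f qs) ≡ step A f (map base qs)
    base-step f qs = cong proj₁ (remQuot-combine _ _)

    bit-step : ∀ f qs d code → bit (step closure f qs) d code ≡ anyApplies f qs d code
    bit-step f qs d code =
      trans (cong (λ x → entry {K = Codes} (proj₂ x) d code) (remQuot-combine {states A} _ _))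
            (entry-toTable (anyApplies f qs) d code)

    base-run : ∀ t → base (run closure t) ≡ run A t
    base-run (node f ts) = begin
      base (run closure (node f ts))                    ≡⟨ base-step f _ ⟩
      step A f (map base (tabulate (run closure ∘ ts))) ≡⟨ cong (step A f) (tabulate-∘ base _) ⟨
      step A f (tabulate (base ∘ run closure ∘ ts))     ≡⟨ cong (step A f) (tabulate-cong (base-run ∘ ts)) ⟩
      run A (node f ts)                                 ∎
      where open ≡-Reasoning

    bit-run : ∀ t d code → T (bit (run closure t) d code) ⇔ ⟦ con d (σ ∘ finToFun code) ⟧ t
    argBit-run : ∀ t {k} (g : Fin k → Fin m) τ →
                 T (argBit (run closure t) g τ) ⇔ ⟦ inst S P (σ ∘ g) τ ⟧ t

    bit-run (node f ts) d code = begin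
      T (bit (run closure (node f ts)) d code)
        ≡⟨ cong T (bit-step f qs d code) ⟩
      T (anyApplies f qs d code)
        ∼⟨ mk⇔ toWitness fromWitness ⟩
      Any (Applies f (λ j g τ → T (argBit (lookup qs j) g τ)) d (finToFun code)) Δ
        ∼⟨ Applies-cong {ρ = finToFun code} argBit-child ⟩
      ⟦ con d (σ ∘ finToFun code) ⟧ (node f ts)
        ∎
      where
      open EquationalReasoning
      qs = tabulate (run closure ∘ ts)
      argBit-child : ∀ j {k} (g : Fin k → Fin m) τ →
                     T (argBit (lookup qs j) g τ) ⇔ ⟦ inst S P (σ ∘ g) τ ⟧ (ts j)
      argBit-child j g τ rewrite lookup∘tabulate (run closure ∘ ts) j = argBit-run (ts j) g τ

    argBit-run t g (par i) rewrite base-run t = decides (g i) t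
    argBit-run t g (app d h) =
      ⇔.trans (bit-run t d (funToFin (g ∘ h))) (con-cong t d (cong σ ∘ finToFun-funToFin (g ∘ h)))

    con-recogniser : ∀ d (g : Fin (arity P d) → Fin m) → Recogniser ⟦ con d (σ ∘ g) ⟧
    con-recogniser d g = record
      { automaton = closure
      ; accepting = λ q → bit q d (funToFin g)
      ; decides   = λ t → ⇔.trans (bit-run t d (funToFin g)) (con-cong t d (cong σ ∘ finToFun-funToFin g))
      }

  recogniser : (M : TExp P) → Recogniser ⟦ M ⟧
  recogniser top       = record { automaton = trivial ; accepting = const true  ; decides = λ _ → mk⇔ _ _ }
  recogniser bot       = record { automaton = trivial ; accepting = const false
                                ; decides = λ _ → mk⇔ (λ ()) (λ ()) }
  recogniser (E₁ ⊓ E₂) = ∩-recogniser (recogniser E₁) (recogniser E₂)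
  recogniser (E₁ ⊔ E₂) = ∪-recogniser (recogniser E₁) (recogniser E₂)
  recogniser (neg E)   = ∁-recogniser (recogniser E)
  recogniser (con c σ) = Closure.con-recogniser σ (⨂-recogniser λ i → recogniser (σ i)) c id

lemma5 : (S P : Ranked) → Σ (Fin (size S)) (λ f → arity S f ≡ 0) →
           (Δ : List (Rule S P)) → (M : TExp P) →
           Regular S (λ t → Mem S P Δ t M)
lemma5 S P _ Δ M = Recogniser⇒Regular (Semantics.recogniser S P Δ M)
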